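{- Let $G$ be a finite graph (multiple edges allowed) with vertex set $V$, edge set $E$, each edge joining two distinct vertices, and every vertex $v$ of positive degree $d_v$. For each $v\in V$ let $C(v)=\{0,1,\dots,k_v\}$ with $k_v\ge1$ an integer. Let $p_m$ be the number of subsets $M\subset E$ with $|M|=m$ such that every vertex $v$ is incident to at most $k_v$ edges of $M$, let $N$ be the largest $m$ with $p_m>0$, and let $P(z)=\sum_{m=0}^Np_mz^m$. Let $\alpha=\max_{v\in V}\max\{d_v-k_v,0\}$. Then for every $z_0>0$, the quantities $T_m=m!\,p_mz_0^m/P(z_0)$ satisfy, for all $0\le m\le N-2$, $$\frac{T_{m+2}}{T_{m+1}}\ge\frac{T_{m+1}}{T_m}-A,\qquad A=(2\alpha+1)z_0.$$
   Formalization: The parameter $z_0$ ranges over the positive rationals. -}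

module Defs where

open import Data.Nat as ℕ using (ℕ; zero; suc; _≤_; _∸_; _⊔_)
open import Data.Nat.Base using (_!)
open import Data.Nat.Properties using (_≤?_)
import Data.Nat.Properties as ℕP
open import Data.Fin using (Fin)
open import Data.Fin.Properties using (all?)
open import Data.Fin.Subset using (Subset; ∣_∣; _∈_; inside; outside)
open import Data.Fin.Subset.Properties using (_∈?_)
open import Data.Bool using (Bool; true; false)
open import Data.List as List using (List; []; _∷_; length; filter; _++_; allFin; foldr)
open import Data.Vec as Vec using (_∷_; [])
open import Data.Product using (_×_; _,_; proj₁; proj₂)
open import Data.Sum using (_⊎_)
open import Data.Integer using (+_)
open import Data.Rational using (ℚ; 0ℚ; 1ℚ; _+_; _*_; _/_; _÷_; ≢-nonZero)
open import Data.Rational.Properties using (_≟_)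
open import Relation.Binary.PropositionalEquality using (_≡_; _≢_)
open import Relation.Nullary using (¬_; yes; no)
open import Relation.Nullary.Decidable using (_×-dec_; _⊎-dec_)
import Data.Fin.Properties as FinP

-- A finite multigraph: vertices Fin n, edges Fin e (so parallel edges are
-- allowed), each edge i has two endpoints ends i, required to be distinct.
record MultiGraph : Set where
  field
    n     : ℕ
    e     : ℕ
    ends  : Fin e → Fin n × Fin n
    loopless : ∀ i → proj₁ (ends i) ≢ proj₂ (ends i)

module _ (G : MultiGraph) where
  open MultiGraph G

  Incident : Fin e → Fin n → Set
  Incident i v = (proj₁ (ends i) ≡ v) ⊎ (proj₂ (ends i) ≡ v)

  incident? : ∀ i v → Relation.Nullary.Dec (Incident i v)
  incident? i v = (proj₁ (ends i) FinP.≟ v) ⊎-dec (proj₂ (ends i) FinP.≟ v)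

  deg : Fin n → ℕ
  deg v = length (filter (λ i → incident? i v) (allFin e))

  degIn : Subset e → Fin n → ℕ
  degIn M v = length (filter (λ i → (i ∈? M) ×-dec incident? i v) (allFin e))

allSubsets : (m : ℕ) → List (Subset m)
allSubsets zero = [] ∷ []
allSubsets (suc m) =
  List.map (outside ∷_) (allSubsets m) ++ List.map (inside ∷_) (allSubsets m)

module _ (G : MultiGraph) (k : Fin (MultiGraph.n G) → ℕ) where
  open MultiGraph G

  Admissible : Subset e → Set
  Admissible M = ∀ v → degIn G M v ≤ k v

  admissible? : ∀ M → Relation.Nullary.Dec (Admissible M)
  admissible? M = all? (λ v → degIn G M v ≤? k v)

  p : ℕ → ℕ
  p m = length (filter (λ M → (∣ M ∣ ℕP.≟ m) ×-dec admissible? M) (allSubsets e))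

  -- α = max over v of max{d_v - k_v, 0}  (natural subtraction ∸ is exactly max{·,0})
  α : ℕ
  α = foldr _⊔_ 0 (List.map (λ v → deg G v ∸ k v) (allFin n))

ℕ→ℚ : ℕ → ℚ
ℕ→ℚ m = (+ m) / 1

_^ℚ_ : ℚ → ℕ → ℚ
x ^ℚ zero = 1ℚ
x ^ℚ suc m = x * (x ^ℚ m)

-- total division (only ever applied to nonzero denominators in the statement)
_÷'_ : ℚ → ℚ → ℚ
x ÷' y with y ≟ 0ℚ
... | yes _ = 0ℚ
... | no y≢0 = _÷_ x y {{≢-nonZero y≢0}}

polyP : (ℕ → ℕ) → ℕ → ℚ → ℚ
polyP p zero z = ℕ→ℚ (p 0)
polyP p (suc N) z = polyP p N z + ℕ→ℚ (p (suc N)) * (z ^ℚ suc N)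

T : (ℕ → ℕ) → ℕ → ℚ → ℕ → ℚ
T p N z0 m = (ℕ→ℚ (m !) * ℕ→ℚ (p m) * (z0 ^ℚ m)) ÷' polyP p N z0

module Submission where

-- Call an edge i ∉ M an extension of an admissible set M if M ∪ {i} is again admissible, and let
-- ext M count them.  Counting pairs (M, i) in two ways gives, summed over the admissible m-sets M,
-- ∑ ext M = (m+1) p_{m+1} and ∑_M ∑_{i extends M} ext (M ∪ {i}) = (m+1)(m+2) p_{m+2}.  Adding an
-- edge i destroys at most 2α+1 extensions of M: apart from i itself, an edge j is lost only if it
-- is free at an endpoint v of i that M ∪ {i} saturates, and such a v has at most d_v − k_v ≤ α free
-- edges.  Hence (ext M)² ≤ ∑_{i extends M} ext (M ∪ {i}) + (2α+1) ext M, and Cauchy–Schwarz gives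
-- ((m+1) p_{m+1})² ≤ p_m ∑_M (ext M)² ≤ (m+1) p_m ((m+2) p_{m+2} + (2α+1) p_{m+1}).  Multiplying by
-- (m+1) (m!)² z₀^{2m+2} / P(z₀)² turns this into T_{m+1}² ≤ T_{m+2} T_m + (2α+1) z₀ T_m T_{m+1},
-- which is the claim after division by T_m T_{m+1}.

open import Data.Nat using (ℕ)
open import Data.Fin using (Fin)
open import Defs

module Sums where

  open import Data.Nat using (ℕ; zero; suc; _+_; _*_; _≤_; z≤n)
  open import Data.Nat.Properties
  open import Data.Nat.Solver using (module +-*-Solver)
  open import Data.Bool using (Bool; true; false; _∧_)
  open import Data.Fin using (Fin; zero; suc)
  open import Data.List using (List; []; _∷_; length; filter; _++_; map; tabulate)
  open import Relation.Nullary using (Dec; yes; no; does; contradiction)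
  open import Relation.Nullary.Decidable using (_×-dec_; does-⇔)
  open import Data.Product using (_×_)
  import Data.Fin.Properties as Fin
  open import Relation.Unary using (Pred; Decidable)
  open import Relation.Binary.PropositionalEquality
  open import Function using (_∘_; _⇔_)
  open import Algebra.Properties.Semiring.Sum +-*-semiring public
    using (sum-syntax; sum-cong-≗; ∑-distrib-+; *-distribˡ-sum; *-distribʳ-sum; sum-replicate-zero)
  open +-*-Solver

  𝟙 : Bool → ℕ
  𝟙 true = 1
  𝟙 false = 0

  𝟙≤1 : ∀ b → 𝟙 b ≤ 1
  𝟙≤1 true  = ≤-refl
  𝟙≤1 false = z≤n

  1≤𝟙 : ∀ {P : Set} (p? : Dec P) → P → 1 ≤ 𝟙 (does p?)
  1≤𝟙 (yes _) _ = ≤-refl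
  1≤𝟙 (no ¬p) p = contradiction p ¬p

  does-true : ∀ {P : Set} (p? : Dec P) → does p? ≡ true → P
  does-true (yes p) _ = p

  𝟙-∧ : ∀ a b → 𝟙 (a ∧ b) ≡ 𝟙 a * 𝟙 b
  𝟙-∧ true  b = sym (+-identityʳ (𝟙 b))
  𝟙-∧ false b = refl

  𝟙*𝟙*-⇔ : ∀ {A B C D : Set} → (A × B) ⇔ (C × D) →
           (a? : Dec A) (b? : Dec B) (c? : Dec C) (d? : Dec D) →
           ∀ x → 𝟙 (does a?) * (𝟙 (does b?) * x) ≡ 𝟙 (does c?) * (𝟙 (does d?) * x)
  𝟙*𝟙*-⇔ A×B⇔C×D a? b? c? d? x = begin
    𝟙 (does a?) * (𝟙 (does b?) * x)  ≡⟨ *-assoc (𝟙 (does a?)) _ x ⟨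
    𝟙 (does a?) * 𝟙 (does b?) * x    ≡⟨ cong (_* x) (𝟙-∧ (does a?) (does b?)) ⟨
    𝟙 (does (a? ×-dec b?)) * x        ≡⟨ cong (λ t → 𝟙 t * x) (does-⇔ A×B⇔C×D (a? ×-dec b?) (c? ×-dec d?)) ⟩
    𝟙 (does (c? ×-dec d?)) * x        ≡⟨ cong (_* x) (𝟙-∧ (does c?) (does d?)) ⟩
    𝟙 (does c?) * 𝟙 (does d?) * x    ≡⟨ *-assoc (𝟙 (does c?)) _ x ⟩
    𝟙 (does c?) * (𝟙 (does d?) * x)  ∎
    where open ≡-Reasoning

  ∑-mono-≤ : ∀ {n} {f g : Fin n → ℕ} → (∀ i → f i ≤ g i) → ∑[ i < n ] f i ≤ ∑[ i < n ] g i
  ∑-mono-≤ {zero} f≤g = z≤n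
  ∑-mono-≤ {suc n} f≤g = +-mono-≤ (f≤g zero) (∑-mono-≤ (f≤g ∘ suc))

  ∑-update : ∀ {n} (f g : Fin n → ℕ) i d → (∀ j → j ≢ i → g j ≡ f j) → g i ≡ f i + d →
             ∑[ j < n ] g j ≡ ∑[ j < n ] f j + d
  ∑-update {suc n} f g zero d g≡f gi≡fi+d = begin
    g zero + ∑[ j < n ] g (suc j)      ≡⟨ cong₂ _+_ gi≡fi+d (sum-cong-≗ (λ j → g≡f (suc j) λ ())) ⟩
    f zero + d + ∑[ j < n ] f (suc j)  ≡⟨ solve 3 (λ a b c → a :+ b :+ c := a :+ c :+ b) refl (f zero) d _ ⟩
    f zero + ∑[ j < n ] f (suc j) + d  ∎
    where open ≡-Reasoning
  ∑-update {suc n} f g (suc i) d g≡f gi≡fi+d = begin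
    g zero + ∑[ j < n ] g (suc j)
      ≡⟨ cong₂ _+_ (g≡f zero λ ()) (∑-update (f ∘ suc) (g ∘ suc) i d g≡f′ gi≡fi+d) ⟩
    f zero + (∑[ j < n ] f (suc j) + d)  ≡⟨ +-assoc (f zero) _ d ⟨
    f zero + ∑[ j < n ] f (suc j) + d    ∎
    where
    open ≡-Reasoning
    g≡f′ : ∀ j → j ≢ i → g (suc j) ≡ f (suc j)
    g≡f′ j j≢i = g≡f (suc j) (j≢i ∘ Fin.suc-injective)

  ∑-≟ : ∀ {n} (i : Fin n) → ∑[ j < n ] 𝟙 (does (j Fin.≟ i)) ≡ 1
  ∑-≟ {suc n} zero    = cong suc (sum-replicate-zero n)
  ∑-≟ {suc n} (suc i) = ∑-≟ i

  length-filter-tabulate : ∀ {A : Set} {p} {P : Pred A p} (P? : Decidable P) {n} (f : Fin n → A) →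
                           length (filter P? (tabulate f)) ≡ ∑[ i < n ] 𝟙 (does (P? (f i)))
  length-filter-tabulate P? {zero}  f = refl
  length-filter-tabulate P? {suc n} f with does (P? (f zero))
  ... | true  = cong suc (length-filter-tabulate P? (f ∘ suc))
  ... | false = length-filter-tabulate P? (f ∘ suc)

  sumOver : {A : Set} → List A → (A → ℕ) → ℕ
  sumOver []       f = 0
  sumOver (x ∷ xs) f = f x + sumOver xs f

  infixl 10 sumOver
  syntax sumOver xs (λ x → t) = ∑[ x ∈ xs ] t

  module _ {A : Set} where

    ∑∈-cong : ∀ xs {f g : A → ℕ} → (∀ x → f x ≡ g x) → ∑[ x ∈ xs ] f x ≡ ∑[ x ∈ xs ] g x
    ∑∈-cong []       f≡g = refl
    ∑∈-cong (x ∷ xs) f≡g = cong₂ _+_ (f≡g x) (∑∈-cong xs f≡g)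

    ∑∈-mono-≤ : ∀ xs {f g : A → ℕ} → (∀ x → f x ≤ g x) → ∑[ x ∈ xs ] f x ≤ ∑[ x ∈ xs ] g x
    ∑∈-mono-≤ []       f≤g = z≤n
    ∑∈-mono-≤ (x ∷ xs) f≤g = +-mono-≤ (f≤g x) (∑∈-mono-≤ xs f≤g)

    ∑∈-distrib-+ : ∀ xs (f g : A → ℕ) → ∑[ x ∈ xs ] (f x + g x) ≡ ∑[ x ∈ xs ] f x + ∑[ x ∈ xs ] g x
    ∑∈-distrib-+ []       f g = refl
    ∑∈-distrib-+ (x ∷ xs) f g = begin
      f x + g x + ∑[ y ∈ xs ] (f y + g y)                  ≡⟨ cong (f x + g x +_) (∑∈-distrib-+ xs f g) ⟩
      f x + g x + (∑[ y ∈ xs ] f y + ∑[ y ∈ xs ] g y)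
        ≡⟨ solve 4 (λ a b c d → a :+ b :+ (c :+ d) := a :+ c :+ (b :+ d)) refl (f x) (g x) _ _ ⟩
      f x + ∑[ y ∈ xs ] f y + (g x + ∑[ y ∈ xs ] g y)      ∎
      where open ≡-Reasoning

    *-distribˡ-∑∈ : ∀ c xs (f : A → ℕ) → c * ∑[ x ∈ xs ] f x ≡ ∑[ x ∈ xs ] (c * f x)
    *-distribˡ-∑∈ c []       f = *-zeroʳ c
    *-distribˡ-∑∈ c (x ∷ xs) f = trans (*-distribˡ-+ c (f x) _) (cong (c * f x +_) (*-distribˡ-∑∈ c xs f))

    ∑∈-++ : ∀ xs ys (f : A → ℕ) → ∑[ x ∈ xs ++ ys ] f x ≡ ∑[ x ∈ xs ] f x + ∑[ y ∈ ys ] f y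
    ∑∈-++ []       ys f = refl
    ∑∈-++ (x ∷ xs) ys f = trans (cong (f x +_) (∑∈-++ xs ys f)) (sym (+-assoc (f x) _ _))

    ∑∈-∑-comm : ∀ {n} xs (f : A → Fin n → ℕ) → ∑[ x ∈ xs ] ∑[ i < n ] f x i ≡ ∑[ i < n ] ∑[ x ∈ xs ] f x i
    ∑∈-∑-comm {n} []       f = sym (sum-replicate-zero n)
    ∑∈-∑-comm     (x ∷ xs) f = trans (cong (∑[ i < _ ] f x i +_) (∑∈-∑-comm xs f)) (sym (∑-distrib-+ (f x) _))

    ∑∈-filter : ∀ {p} {P : Pred A p} (P? : Decidable P) xs (f : A → ℕ) →
                ∑[ x ∈ filter P? xs ] f x ≡ ∑[ x ∈ xs ] (𝟙 (does (P? x)) * f x)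
    ∑∈-filter P? []       f = refl
    ∑∈-filter P? (x ∷ xs) f with does (P? x)
    ... | true  = cong₂ _+_ (sym (+-identityʳ (f x))) (∑∈-filter P? xs f)
    ... | false = ∑∈-filter P? xs f

    ∑∈-1 : ∀ (xs : List A) → ∑[ x ∈ xs ] 1 ≡ length xs
    ∑∈-1 []       = refl
    ∑∈-1 (x ∷ xs) = cong suc (∑∈-1 xs)

  ∑∈-map : ∀ {A B : Set} (g : A → B) xs (f : B → ℕ) → ∑[ y ∈ map g xs ] f y ≡ ∑[ x ∈ xs ] f (g x)
  ∑∈-map g []       f = refl
  ∑∈-map g (x ∷ xs) f = cong (f (g x) +_) (∑∈-map g xs f)

  2*m*n≤m*m+n*n : ∀ m n → 2 * m * n ≤ m * m + n * n
  2*m*n≤m*m+n*n zero    n       = z≤n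
  2*m*n≤m*m+n*n (suc m) zero    = ≤-trans (≤-reflexive (*-zeroʳ (2 * suc m))) z≤n
  2*m*n≤m*m+n*n (suc m) (suc n) = begin
    2 * suc m * suc n
      ≡⟨ solve 2 (λ m n → con 2 :* (con 1 :+ m) :* (con 1 :+ n) := con 2 :* m :* n :+ con 2 :* (m :+ n :+ con 1)) refl m n ⟩
    2 * m * n + 2 * (m + n + 1)
      ≤⟨ +-monoˡ-≤ _ (2*m*n≤m*m+n*n m n) ⟩
    m * m + n * n + 2 * (m + n + 1)
      ≡⟨ solve 2 (λ m n → m :* m :+ n :* n :+ con 2 :* (m :+ n :+ con 1)
                          := (con 1 :+ m) :* (con 1 :+ m) :+ (con 1 :+ n) :* (con 1 :+ n)) refl m n ⟩
    suc m * suc m + suc n * suc n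
      ∎
    where open ≤-Reasoning

  module _ {A : Set} (f : A → ℕ) where

    private
      2*y*∑≤ : ∀ y xs → 2 * y * ∑[ x ∈ xs ] f x ≤ length xs * (y * y) + ∑[ x ∈ xs ] (f x * f x)
      2*y*∑≤ y []       = ≤-reflexive (*-zeroʳ (2 * y))
      2*y*∑≤ y (x ∷ xs) = begin
        2 * y * (f x + S)
          ≡⟨ *-distribˡ-+ (2 * y) (f x) S ⟩
        2 * y * f x + 2 * y * S
          ≤⟨ +-mono-≤ (2*m*n≤m*m+n*n y (f x)) (2*y*∑≤ y xs) ⟩
        y * y + f x * f x + (n * (y * y) + Q)
          ≡⟨ solve 4 (λ yy ff n Q → yy :+ ff :+ (n :* yy :+ Q) := (con 1 :+ n) :* yy :+ (ff :+ Q)) refl (y * y) (f x * f x) n Q ⟩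
        suc n * (y * y) + (f x * f x + Q)
          ∎
        where open ≤-Reasoning
              S Q n : ℕ
              S = ∑[ x ∈ xs ] f x
              Q = ∑[ x ∈ xs ] (f x * f x)
              n = length xs

    cauchy-schwarz : ∀ xs → (∑[ x ∈ xs ] f x) * (∑[ x ∈ xs ] f x) ≤ length xs * ∑[ x ∈ xs ] (f x * f x)
    cauchy-schwarz []       = z≤n
    cauchy-schwarz (x ∷ xs) = begin
      (f x + S) * (f x + S)
        ≡⟨ solve 2 (λ a S → (a :+ S) :* (a :+ S) := a :* a :+ con 2 :* a :* S :+ S :* S) refl (f x) S ⟩
      f x * f x + 2 * f x * S + S * S
        ≤⟨ +-mono-≤ (+-monoʳ-≤ (f x * f x) (2*y*∑≤ (f x) xs)) (cauchy-schwarz xs) ⟩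
      f x * f x + (n * (f x * f x) + Q) + n * Q
        ≡⟨ solve 3 (λ aa n Q → aa :+ (n :* aa :+ Q) :+ n :* Q := (con 1 :+ n) :* (aa :+ Q)) refl (f x * f x) n Q ⟩
      suc n * (f x * f x + Q)
        ∎
      where open ≤-Reasoning
            S Q n : ℕ
            S = ∑[ x ∈ xs ] f x
            Q = ∑[ x ∈ xs ] (f x * f x)
            n = length xs

module Subsets where

  open Sums
  open import Data.Nat using (ℕ; zero; suc; _+_; _*_)
  open import Data.Nat.Properties using (+-comm)
  open import Data.Bool using (true; false)
  open import Data.Fin using (Fin; zero; suc)
  open import Data.Fin.Subset using (Subset; ∣_∣; inside; outside; _∉_)
  open import Data.Fin.Subset.Properties using (_∈?_)
  open import Data.List using (map)
  open import Data.Vec using (_∷_; []; lookup; _[_]≔_; here; there)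
  open import Data.Vec.Properties using (lookup∘update; lookup∘update′; []=⇒lookup; lookup⇒[]=)
  open import Relation.Nullary using (Dec; does; ¬?; contradiction)
  open import Function using (_∘′_)
  open import Relation.Binary.PropositionalEquality

  _∪⁅_⁆ : ∀ {n} → Subset n → Fin n → Subset n
  M ∪⁅ i ⁆ = M [ i ]≔ inside

  _∉?_ : ∀ {n} (i : Fin n) (M : Subset n) → Dec (i ∉ M)
  i ∉? M = ¬? (i ∈? M)

  does-∈? : ∀ {n} (i : Fin n) (M : Subset n) → does (i ∈? M) ≡ lookup M i
  does-∈? zero    (true  ∷ M) = refl
  does-∈? zero    (false ∷ M) = refl
  does-∈? (suc i) (b     ∷ M) = does-∈? i M

  does-∈?-∪⁅⁆ : ∀ {n} (M : Subset n) i → does (i ∈? M ∪⁅ i ⁆) ≡ true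
  does-∈?-∪⁅⁆ M i = trans (does-∈? i (M ∪⁅ i ⁆)) (lookup∘update i M inside)

  does-∈?-∪⁅⁆′ : ∀ {n} (M : Subset n) {i j} → j ≢ i → does (j ∈? M ∪⁅ i ⁆) ≡ does (j ∈? M)
  does-∈?-∪⁅⁆′ M {i} {j} j≢i = trans (does-∈? j (M ∪⁅ i ⁆)) (trans (lookup∘update′ j≢i M inside) (sym (does-∈? j M)))

  ∉-∪⁅⁆ : ∀ {n} (M : Subset n) {i j} → j ∉ M → j ≢ i → j ∉ M ∪⁅ i ⁆
  ∉-∪⁅⁆ M {i} {j} j∉M j≢i j∈M∪i =
    j∉M (lookup⇒[]= j M (trans (sym (lookup∘update′ j≢i M inside)) ([]=⇒lookup j∈M∪i)))

  ∣∣≡∑ : ∀ {n} (M : Subset n) → ∣ M ∣ ≡ ∑[ i < n ] 𝟙 (does (i ∈? M))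
  ∣∣≡∑ []          = refl
  ∣∣≡∑ (true  ∷ M) = cong suc (∣∣≡∑ M)
  ∣∣≡∑ (false ∷ M) = ∣∣≡∑ M

  ∣∪⁅⁆∣ : ∀ {n} (M : Subset n) i → i ∉ M → ∣ M ∪⁅ i ⁆ ∣ ≡ suc ∣ M ∣
  ∣∪⁅⁆∣ (false ∷ M) zero    i∉M = refl
  ∣∪⁅⁆∣ (true  ∷ M) zero    i∉M = contradiction here i∉M
  ∣∪⁅⁆∣ (true  ∷ M) (suc i) i∉M = cong suc (∣∪⁅⁆∣ M i (i∉M ∘′ there))
  ∣∪⁅⁆∣ (false ∷ M) (suc i) i∉M = ∣∪⁅⁆∣ M i (i∉M ∘′ there)

  ∑-allSubsets-suc : ∀ {n} (F : Subset (suc n) → ℕ) →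
    ∑[ M ∈ allSubsets (suc n) ] F M ≡ ∑[ M ∈ allSubsets n ] F (outside ∷ M) + ∑[ M ∈ allSubsets n ] F (inside ∷ M)
  ∑-allSubsets-suc {n} F = trans (∑∈-++ (map (outside ∷_) (allSubsets n)) _ F)
    (cong₂ _+_ (∑∈-map (outside ∷_) (allSubsets n) F) (∑∈-map (inside ∷_) (allSubsets n) F))

  ∑-∪⁅⁆ : ∀ {n} (F : Subset n → ℕ) i →
    ∑[ M ∈ allSubsets n ] (𝟙 (does (i ∉? M)) * F (M ∪⁅ i ⁆)) ≡ ∑[ M ∈ allSubsets n ] (𝟙 (does (i ∈? M)) * F M)
  ∑-∪⁅⁆ {suc n} F zero = begin
    ∑[ M ∈ allSubsets (suc n) ] (𝟙 (does (zero ∉? M)) * F (M ∪⁅ zero ⁆))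
      ≡⟨ ∑-allSubsets-suc (λ M → 𝟙 (does (zero ∉? M)) * F (M ∪⁅ zero ⁆)) ⟩
    ∑[ M ∈ allSubsets n ] (1 * F (inside ∷ M)) + ∑[ M ∈ allSubsets n ] 0
      ≡⟨ +-comm (∑[ M ∈ allSubsets n ] (1 * F (inside ∷ M))) _ ⟩
    ∑[ M ∈ allSubsets n ] 0 + ∑[ M ∈ allSubsets n ] (1 * F (inside ∷ M))
      ≡⟨ ∑-allSubsets-suc (λ M → 𝟙 (does (zero ∈? M)) * F M) ⟨
    ∑[ M ∈ allSubsets (suc n) ] (𝟙 (does (zero ∈? M)) * F M) ∎
    where open ≡-Reasoning
  ∑-∪⁅⁆ {suc n} F (suc i) = begin
    ∑[ M ∈ allSubsets (suc n) ] (𝟙 (does (suc i ∉? M)) * F (M ∪⁅ suc i ⁆))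
      ≡⟨ ∑-allSubsets-suc (λ M → 𝟙 (does (suc i ∉? M)) * F (M ∪⁅ suc i ⁆)) ⟩
    ∑[ M ∈ allSubsets n ] (𝟙 (does (i ∉? M)) * F (outside ∷ M ∪⁅ i ⁆))
      + ∑[ M ∈ allSubsets n ] (𝟙 (does (i ∉? M)) * F (inside ∷ M ∪⁅ i ⁆))
      ≡⟨ cong₂ _+_ (∑-∪⁅⁆ (λ M → F (outside ∷ M)) i) (∑-∪⁅⁆ (λ M → F (inside ∷ M)) i) ⟩
    ∑[ M ∈ allSubsets n ] (𝟙 (does (i ∈? M)) * F (outside ∷ M)) + ∑[ M ∈ allSubsets n ] (𝟙 (does (i ∈? M)) * F (inside ∷ M))
      ≡⟨ ∑-allSubsets-suc (λ M → 𝟙 (does (suc i ∈? M)) * F M) ⟨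
    ∑[ M ∈ allSubsets (suc n) ] (𝟙 (does (suc i ∈? M)) * F M) ∎
    where open ≡-Reasoning

  ∑-∑-∪⁅⁆ : ∀ {n} (F : Subset n → ℕ) →
    ∑[ i < n ] ∑[ M ∈ allSubsets n ] (𝟙 (does (i ∉? M)) * F (M ∪⁅ i ⁆)) ≡ ∑[ M ∈ allSubsets n ] (∣ M ∣ * F M)
  ∑-∑-∪⁅⁆ {n} F = begin
    ∑[ i < n ] ∑[ M ∈ allSubsets n ] (𝟙 (does (i ∉? M)) * F (M ∪⁅ i ⁆)) ≡⟨ sum-cong-≗ (∑-∪⁅⁆ F) ⟩
    ∑[ i < n ] ∑[ M ∈ allSubsets n ] (𝟙 (does (i ∈? M)) * F M)
      ≡⟨ ∑∈-∑-comm (allSubsets n) (λ M i → 𝟙 (does (i ∈? M)) * F M) ⟨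
    ∑[ M ∈ allSubsets n ] ∑[ i < n ] (𝟙 (does (i ∈? M)) * F M)
      ≡⟨ ∑∈-cong (allSubsets n) (λ M → *-distribʳ-sum (F M) (λ i → 𝟙 (does (i ∈? M)))) ⟨
    ∑[ M ∈ allSubsets n ] (∑[ i < n ] 𝟙 (does (i ∈? M)) * F M)
      ≡⟨ ∑∈-cong (allSubsets n) (λ M → cong (_* F M) (∣∣≡∑ M)) ⟨
    ∑[ M ∈ allSubsets n ] (∣ M ∣ * F M) ∎
    where open ≡-Reasoning

module Extensions (G : MultiGraph) (k : Fin (MultiGraph.n G) → ℕ) where

  open Sums
  open Subsets
  open MultiGraph G
  open import Data.Nat using (ℕ; suc; _+_; _*_; _≤_; _<_; _∸_; _⊔_; _≤?_; z≤n; s≤s)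
  open import Data.Nat.Properties
  open import Data.Nat.Solver using (module +-*-Solver)
  open import Data.Bool using (Bool; true; false; not; _∧_)
  open import Data.Fin using (Fin)
  import Data.Fin.Properties as Fin
  open import Data.Fin.Subset using (Subset; ∣_∣; _∉_)
  open import Data.Fin.Subset.Properties using (_∈?_)
  open import Data.List using (List; foldr; map; filter)
  open import Data.List.Membership.Propositional using (_∈_)
  open import Data.List.Membership.Propositional.Properties using (∈-allFin)
  open import Data.List.Relation.Unary.Any using (here; there)
  open import Data.Product using (∃; _×_; _,_; proj₁; proj₂)
  open import Data.Sum using (inj₁; inj₂)
  open import Relation.Nullary using (Dec; yes; no; does; ¬_; contradiction)
  open import Relation.Nullary.Decidable using (dec-false; _×-dec_)
  open import Relation.Binary.PropositionalEquality
  open import Function using (_∘_; id; _⇔_; mk⇔)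
  open +-*-Solver

  incidentᵇ : Fin e → Fin n → Bool
  incidentᵇ i v = does (incident? G i v)

  Extends : Subset e → Fin e → Set
  Extends M i = i ∉ M × Admissible G k (M ∪⁅ i ⁆)

  extends? : ∀ M i → Dec (Extends M i)
  extends? M i = (i ∉? M) ×-dec admissible? G k (M ∪⁅ i ⁆)

  ext : Subset e → ℕ
  ext M = ∑[ i < e ] 𝟙 (does (extends? M i))

  Free : Subset e → Fin n → Fin e → Set
  Free M v j = j ∉ M × Incident G j v

  free? : ∀ M v j → Dec (Free M v j)
  free? M v j = (j ∉? M) ×-dec incident? G j v

  free : Subset e → Fin n → ℕ
  free M v = ∑[ j < e ] 𝟙 (does (free? M v j))

  Blocked : Subset e → Fin n → Fin e → Set
  Blocked M v j = k v ≤ degIn G M v × Free M v j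

  blocked? : ∀ M v j → Dec (Blocked M v j)
  blocked? M v j = (k v ≤? degIn G M v) ×-dec free? M v j

  deg-∑ : ∀ v → deg G v ≡ ∑[ j < e ] 𝟙 (incidentᵇ j v)
  deg-∑ v = length-filter-tabulate (λ j → incident? G j v) id

  degIn-∑ : ∀ M v → degIn G M v ≡ ∑[ j < e ] 𝟙 (does (j ∈? M) ∧ incidentᵇ j v)
  degIn-∑ M v = length-filter-tabulate (λ j → (j ∈? M) ×-dec incident? G j v) id

  degIn-∪⁅⁆ : ∀ M i v → i ∉ M → degIn G (M ∪⁅ i ⁆) v ≡ degIn G M v + 𝟙 (incidentᵇ i v)
  degIn-∪⁅⁆ M i v i∉M = begin
    degIn G (M ∪⁅ i ⁆) v                                   ≡⟨ degIn-∑ (M ∪⁅ i ⁆) v ⟩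
    ∑[ j < e ] 𝟙 (does (j ∈? M ∪⁅ i ⁆) ∧ incidentᵇ j v)          ≡⟨ ∑-update _ _ i (𝟙 (incidentᵇ i v)) other this ⟩
    ∑[ j < e ] 𝟙 (does (j ∈? M) ∧ incidentᵇ j v) + 𝟙 (incidentᵇ i v)   ≡⟨ cong (_+ 𝟙 (incidentᵇ i v)) (degIn-∑ M v) ⟨
    degIn G M v + 𝟙 (incidentᵇ i v)                              ∎
    where
    open ≡-Reasoning
    other : ∀ j → j ≢ i → 𝟙 (does (j ∈? M ∪⁅ i ⁆) ∧ incidentᵇ j v) ≡ 𝟙 (does (j ∈? M) ∧ incidentᵇ j v)
    other j j≢i = cong (λ b → 𝟙 (b ∧ incidentᵇ j v)) (does-∈?-∪⁅⁆′ M j≢i)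
    this : 𝟙 (does (i ∈? M ∪⁅ i ⁆) ∧ incidentᵇ i v) ≡ 𝟙 (does (i ∈? M) ∧ incidentᵇ i v) + 𝟙 (incidentᵇ i v)
    this rewrite does-∈?-∪⁅⁆ M i | dec-false (i ∈? M) i∉M = refl

  admissible-∪⁅⁆⁻ : ∀ M i → i ∉ M → Admissible G k (M ∪⁅ i ⁆) → Admissible G k M
  admissible-∪⁅⁆⁻ M i i∉M M∪i-adm v =
    ≤-trans (m≤m+n _ _) (subst (_≤ k v) (degIn-∪⁅⁆ M i v i∉M) (M∪i-adm v))

  degIn+free≡deg : ∀ M v → degIn G M v + free M v ≡ deg G v
  degIn+free≡deg M v = begin
    degIn G M v + free M v                                ≡⟨ cong (_+ free M v) (degIn-∑ M v) ⟩
    ∑[ j < e ] 𝟙 (does (j ∈? M) ∧ incidentᵇ j v) + free M v     ≡⟨ ∑-distrib-+ (λ j → 𝟙 (does (j ∈? M) ∧ incidentᵇ j v)) _ ⟨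
    ∑[ j < e ] (𝟙 (does (j ∈? M) ∧ incidentᵇ j v) + 𝟙 (not (does (j ∈? M)) ∧ incidentᵇ j v))
                                                          ≡⟨ sum-cong-≗ (λ j → split (does (j ∈? M)) (incidentᵇ j v)) ⟩
    ∑[ j < e ] 𝟙 (incidentᵇ j v)                                ≡⟨ deg-∑ v ⟨
    deg G v                                               ∎
    where
    open ≡-Reasoning
    split : ∀ a b → 𝟙 (a ∧ b) + 𝟙 (not a ∧ b) ≡ 𝟙 b
    split true  b = +-identityʳ (𝟙 b)
    split false b = refl

  ≤-foldr-⊔ : ∀ {A : Set} (f : A → ℕ) {x xs} → x ∈ xs → f x ≤ foldr _⊔_ 0 (map f xs)
  ≤-foldr-⊔ f (here refl)  = m≤m⊔n _ _
  ≤-foldr-⊔ f (there x∈xs) = ≤-trans (≤-foldr-⊔ f x∈xs) (m≤n⊔m _ _)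

  free≤α : ∀ M v → k v ≤ degIn G M v → free M v ≤ α G k
  free≤α M v saturated = begin
    free M v                               ≡⟨ m+n∸m≡n (degIn G M v) (free M v) ⟨
    degIn G M v + free M v ∸ degIn G M v   ≡⟨ cong (_∸ degIn G M v) (degIn+free≡deg M v) ⟩
    deg G v ∸ degIn G M v                  ≤⟨ ∸-monoʳ-≤ (deg G v) saturated ⟩
    deg G v ∸ k v                          ≤⟨ ≤-foldr-⊔ (λ u → deg G u ∸ k u) (∈-allFin v) ⟩
    α G k                                  ∎
    where open ≤-Reasoning

  ∑-blocked≤α : ∀ M v → ∑[ j < e ] 𝟙 (does (blocked? M v j)) ≤ α G k
  ∑-blocked≤α M v = bound (k v ≤? degIn G M v)
    where
    -- Here and below a decision is split on through a helper argument: `with` cannot abstract it,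
    -- because `does` of a `_×-dec_` has already been unfolded in the goal.
    bound : ∀ s → ∑[ j < e ] 𝟙 (does s ∧ does (free? M v j)) ≤ α G k
    bound (yes saturated) = free≤α M v saturated
    bound (no _)          = ≤-trans (≤-reflexive (sum-replicate-zero e)) z≤n

  -- d, dᵢ, dⱼ, dᵢⱼ are the degrees of a vertex in M, M ∪ {i}, M ∪ {j}, M ∪ {i, j}, and a, b say
  -- whether i, j are incident to it.
  overflow-needs-both : ∀ {d dᵢ dⱼ dᵢⱼ κ} a b → dᵢ ≡ d + 𝟙 a → dⱼ ≡ d + 𝟙 b → dᵢⱼ ≡ dᵢ + 𝟙 b →
                        dᵢ ≤ κ → dⱼ ≤ κ → κ < dᵢⱼ → a ≡ true × b ≡ true × κ ≤ dᵢ
  overflow-needs-both {κ = κ} true  true  refl refl refl _    _    κ<dᵢⱼ =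
    refl , refl , m<1+n⇒m≤n (subst (κ <_) (+-comm _ 1) κ<dᵢⱼ)
  overflow-needs-both {κ = κ} false b     refl refl refl _    dⱼ≤κ κ<dᵢⱼ =
    contradiction dⱼ≤κ (<⇒≱ (subst (κ <_) (cong (_+ 𝟙 b) (+-identityʳ _)) κ<dᵢⱼ))
  overflow-needs-both {κ = κ} true  false refl refl refl dᵢ≤κ _    κ<dᵢⱼ =
    contradiction dᵢ≤κ (<⇒≱ (subst (κ <_) (+-identityʳ _) κ<dᵢⱼ))

  blocking-vertex : ∀ M i j → i ∉ M → j ∉ M → j ≢ i →
    Admissible G k (M ∪⁅ i ⁆) → Admissible G k (M ∪⁅ j ⁆) → ¬ Admissible G k (M ∪⁅ i ⁆ ∪⁅ j ⁆) →
    ∃ λ v → Incident G i v × Incident G j v × k v ≤ degIn G (M ∪⁅ i ⁆) v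
  blocking-vertex M i j i∉M j∉M j≢i M∪i-adm M∪j-adm ¬M∪i∪j-adm
    with v , overflow ← Fin.¬∀⟶∃¬ n _ (λ v → degIn G (M ∪⁅ i ⁆ ∪⁅ j ⁆) v ≤? k v) ¬M∪i∪j-adm
    with i∼v , j∼v , saturated ← overflow-needs-both (incidentᵇ i v) (incidentᵇ j v)
           (degIn-∪⁅⁆ M i v i∉M) (degIn-∪⁅⁆ M j v j∉M) (degIn-∪⁅⁆ (M ∪⁅ i ⁆) j v (∉-∪⁅⁆ M j∉M j≢i))
           (M∪i-adm v) (M∪j-adm v) (≰⇒> overflow)
    = v , does-true (incident? G i v) i∼v , does-true (incident? G j v) j∼v , saturated

  extends-∪⁅⁆ : ∀ M i j → i ∉ M → Admissible G k (M ∪⁅ i ⁆) →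
    𝟙 (does (extends? M j)) ≤ 𝟙 (does (extends? (M ∪⁅ i ⁆) j)) + 𝟙 (does (j Fin.≟ i))
      + (𝟙 (does (blocked? (M ∪⁅ i ⁆) (proj₁ (ends i)) j)) + 𝟙 (does (blocked? (M ∪⁅ i ⁆) (proj₂ (ends i)) j)))
  extends-∪⁅⁆ M i j i∉M M∪i-adm = bound (j Fin.≟ i) (extends? M j) (extends? (M ∪⁅ i ⁆) j)
    where
    blockedᵤ blockedᵥ blockedAtEnds : ℕ
    blockedᵤ = 𝟙 (does (blocked? (M ∪⁅ i ⁆) (proj₁ (ends i)) j))
    blockedᵥ = 𝟙 (does (blocked? (M ∪⁅ i ⁆) (proj₂ (ends i)) j))
    blockedAtEnds = blockedᵤ + blockedᵥ
    bound : (j≟i : Dec (j ≡ i)) (ext? : Dec (Extends M j)) (ext′? : Dec (Extends (M ∪⁅ i ⁆) j)) →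
            𝟙 (does ext?) ≤ 𝟙 (does ext′?) + 𝟙 (does j≟i) + blockedAtEnds
    bound (yes _) ext? ext′? = ≤-trans (𝟙≤1 (does ext?)) (≤-trans (m≤n+m 1 (𝟙 (does ext′?))) (m≤m+n _ blockedAtEnds))
    bound (no _)   (no _)  _       = z≤n
    bound (no _)   (yes _) (yes _) = s≤s z≤n
    bound (no j≢i) (yes (j∉M , M∪j-adm)) (no ¬ext′)
      with j∉M∪i ← ∉-∪⁅⁆ M j∉M j≢i
      with v , i∼v , j∼v , saturated ← blocking-vertex M i j i∉M j∉M j≢i M∪i-adm M∪j-adm (¬ext′ ∘ (j∉M∪i ,_))
      with i∼v
    ... | inj₁ refl = ≤-trans (1≤𝟙 (blocked? _ _ j) (saturated , j∉M∪i , j∼v)) (m≤m+n blockedᵤ blockedᵥ)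
    ... | inj₂ refl = ≤-trans (1≤𝟙 (blocked? _ _ j) (saturated , j∉M∪i , j∼v)) (m≤n+m blockedᵥ blockedᵤ)

  ext-∪⁅⁆ : ∀ M i → i ∉ M → Admissible G k (M ∪⁅ i ⁆) → ext M ≤ ext (M ∪⁅ i ⁆) + (2 * α G k + 1)
  ext-∪⁅⁆ M i i∉M M∪i-adm = begin
    ext M                                                ≤⟨ ∑-mono-≤ (λ j → extends-∪⁅⁆ M i j i∉M M∪i-adm) ⟩
    ∑[ j < e ] (E′ j + δ j + (Bᵤ j + Bᵥ j))              ≡⟨ ∑-distrib-+ (λ j → E′ j + δ j) (λ j → Bᵤ j + Bᵥ j) ⟩
    ∑[ j < e ] (E′ j + δ j) + ∑[ j < e ] (Bᵤ j + Bᵥ j)    ≡⟨ cong₂ _+_ (∑-distrib-+ E′ δ) (∑-distrib-+ Bᵤ Bᵥ) ⟩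
    ext M′ + ∑[ j < e ] δ j + (∑[ j < e ] Bᵤ j + ∑[ j < e ] Bᵥ j)
      ≤⟨ +-mono-≤ (+-monoʳ-≤ (ext M′) (≤-reflexive (∑-≟ i))) (+-mono-≤ (∑-blocked≤α M′ _) (∑-blocked≤α M′ _)) ⟩
    ext M′ + 1 + (α G k + α G k)
      ≡⟨ solve 2 (λ x a → x :+ con 1 :+ (a :+ a) := x :+ (con 2 :* a :+ con 1)) refl (ext M′) (α G k) ⟩
    ext M′ + (2 * α G k + 1)                             ∎
    where
    open ≤-Reasoning
    M′ : Subset e
    M′ = M ∪⁅ i ⁆
    E′ δ Bᵤ Bᵥ : Fin e → ℕ
    E′ j = 𝟙 (does (extends? M′ j))
    δ  j = 𝟙 (does (j Fin.≟ i))
    Bᵤ j = 𝟙 (does (blocked? M′ (proj₁ (ends i)) j))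
    Bᵥ j = 𝟙 (does (blocked? M′ (proj₂ (ends i)) j))

  ext²≤ : ∀ M → ext M * ext M ≤ ∑[ i < e ] (𝟙 (does (extends? M i)) * ext (M ∪⁅ i ⁆)) + (2 * α G k + 1) * ext M
  ext²≤ M = begin
    ext M * ext M                                  ≡⟨ *-distribʳ-sum (ext M) E ⟩
    ∑[ i < e ] (E i * ext M)                       ≤⟨ ∑-mono-≤ (λ i → bound i (extends? M i)) ⟩
    ∑[ i < e ] (E i * (ext (M ∪⁅ i ⁆) + c))        ≡⟨ sum-cong-≗ (λ i → *-distribˡ-+ (E i) _ c) ⟩
    ∑[ i < e ] (E i * ext (M ∪⁅ i ⁆) + E i * c)    ≡⟨ ∑-distrib-+ (λ i → E i * ext (M ∪⁅ i ⁆)) (λ i → E i * c) ⟩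
    S + ∑[ i < e ] (E i * c)                       ≡⟨ cong (S +_) (*-distribʳ-sum c E) ⟨
    S + ext M * c                                  ≡⟨ cong (S +_) (*-comm (ext M) c) ⟩
    S + c * ext M                                  ∎
    where
    open ≤-Reasoning
    c : ℕ
    c = 2 * α G k + 1
    E : Fin e → ℕ
    E i = 𝟙 (does (extends? M i))
    S : ℕ
    S = ∑[ i < e ] (E i * ext (M ∪⁅ i ⁆))
    bound : ∀ i (ext? : Dec (Extends M i)) → 𝟙 (does ext?) * ext M ≤ 𝟙 (does ext?) * (ext (M ∪⁅ i ⁆) + c)
    bound i (yes (i∉M , M∪i-adm)) = *-monoʳ-≤ 1 (ext-∪⁅⁆ M i i∉M M∪i-adm)
    bound i (no _)                = z≤n

  AdmissibleOfSize : ℕ → Subset e → Set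
  AdmissibleOfSize m M = ∣ M ∣ ≡ m × Admissible G k M

  admissibleOfSize? : ∀ m M → Dec (AdmissibleOfSize m M)
  admissibleOfSize? m M = (∣ M ∣ ≟ m) ×-dec admissible? G k M

  admissibleSets : ℕ → List (Subset e)
  admissibleSets m = filter (admissibleOfSize? m) (allSubsets e)

  ofSize×extends⇔ : ∀ m M i →
    (AdmissibleOfSize m M × Extends M i) ⇔ (i ∉ M × AdmissibleOfSize (suc m) (M ∪⁅ i ⁆))
  ofSize×extends⇔ m M i = mk⇔
    (λ ((∣M∣≡m , _) , i∉M , M∪i-adm) → i∉M , trans (∣∪⁅⁆∣ M i i∉M) (cong suc ∣M∣≡m) , M∪i-adm)
    (λ (i∉M , ∣M∪i∣≡1+m , M∪i-adm) →
       (suc-injective (trans (sym (∣∪⁅⁆∣ M i i∉M)) ∣M∪i∣≡1+m) , admissible-∪⁅⁆⁻ M i i∉M M∪i-adm) , i∉M , M∪i-adm)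

  ∣∣*𝟙-ofSize : ∀ m M x → ∣ M ∣ * (𝟙 (does (admissibleOfSize? m M)) * x) ≡ m * (𝟙 (does (admissibleOfSize? m M)) * x)
  ∣∣*𝟙-ofSize m M x = weight (admissibleOfSize? m M)
    where
    weight : (d : Dec (AdmissibleOfSize m M)) → ∣ M ∣ * (𝟙 (does d) * x) ≡ m * (𝟙 (does d) * x)
    weight (yes (∣M∣≡m , _)) = cong (_* (1 * x)) ∣M∣≡m
    weight (no _)            = trans (*-zeroʳ ∣ M ∣) (sym (*-zeroʳ m))

  ∑-extensions : ∀ m (F : Subset e → ℕ) →
    ∑[ M ∈ admissibleSets m ] ∑[ i < e ] (𝟙 (does (extends? M i)) * F (M ∪⁅ i ⁆))
      ≡ suc m * ∑[ M ∈ admissibleSets (suc m) ] F M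
  ∑-extensions m F = begin
    ∑[ M ∈ admissibleSets m ] ∑[ i < e ] (𝟙 (does (extends? M i)) * F (M ∪⁅ i ⁆))
      ≡⟨ ∑∈-filter (admissibleOfSize? m) (allSubsets e) _ ⟩
    ∑[ M ∈ allSubsets e ] (𝟙 (does (admissibleOfSize? m M)) * ∑[ i < e ] (𝟙 (does (extends? M i)) * F (M ∪⁅ i ⁆)))
      ≡⟨ ∑∈-cong (allSubsets e) reweight ⟩
    ∑[ M ∈ allSubsets e ] ∑[ i < e ] (𝟙 (does (i ∉? M)) * W (M ∪⁅ i ⁆))
      ≡⟨ ∑∈-∑-comm (allSubsets e) (λ M i → 𝟙 (does (i ∉? M)) * W (M ∪⁅ i ⁆)) ⟩
    ∑[ i < e ] ∑[ M ∈ allSubsets e ] (𝟙 (does (i ∉? M)) * W (M ∪⁅ i ⁆))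
      ≡⟨ ∑-∑-∪⁅⁆ W ⟩
    ∑[ M ∈ allSubsets e ] (∣ M ∣ * W M)
      ≡⟨ ∑∈-cong (allSubsets e) (λ M → ∣∣*𝟙-ofSize (suc m) M (F M)) ⟩
    ∑[ M ∈ allSubsets e ] (suc m * W M)
      ≡⟨ *-distribˡ-∑∈ (suc m) (allSubsets e) W ⟨
    suc m * ∑[ M ∈ allSubsets e ] W M
      ≡⟨ cong (suc m *_) (∑∈-filter (admissibleOfSize? (suc m)) (allSubsets e) F) ⟨
    suc m * ∑[ M ∈ admissibleSets (suc m) ] F M ∎
    where
    open ≡-Reasoning
    W : Subset e → ℕ
    W M = 𝟙 (does (admissibleOfSize? (suc m) M)) * F M
    reweight : ∀ M → 𝟙 (does (admissibleOfSize? m M)) * ∑[ i < e ] (𝟙 (does (extends? M i)) * F (M ∪⁅ i ⁆))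
                     ≡ ∑[ i < e ] (𝟙 (does (i ∉? M)) * W (M ∪⁅ i ⁆))
    reweight M = trans
      (*-distribˡ-sum (𝟙 (does (admissibleOfSize? m M))) (λ i → 𝟙 (does (extends? M i)) * F (M ∪⁅ i ⁆)))
      (sum-cong-≗ λ i → 𝟙*𝟙*-⇔ (ofSize×extends⇔ m M i) (admissibleOfSize? m M) (extends? M i)
                                (i ∉? M) (admissibleOfSize? (suc m) (M ∪⁅ i ⁆)) (F (M ∪⁅ i ⁆)))

  ∑-ext : ∀ m → ∑[ M ∈ admissibleSets m ] ext M ≡ suc m * p G k (suc m)
  ∑-ext m = begin
    ∑[ M ∈ admissibleSets m ] ext M
      ≡⟨ ∑∈-cong (admissibleSets m) (λ M → sum-cong-≗ λ i → sym (*-identityʳ (𝟙 (does (extends? M i))))) ⟩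
    ∑[ M ∈ admissibleSets m ] ∑[ i < e ] (𝟙 (does (extends? M i)) * 1)
      ≡⟨ ∑-extensions m (λ _ → 1) ⟩
    suc m * ∑[ M ∈ admissibleSets (suc m) ] 1
      ≡⟨ cong (suc m *_) (∑∈-1 (admissibleSets (suc m))) ⟩
    suc m * p G k (suc m) ∎
    where open ≡-Reasoning

  ∑-ext² : ∀ m → ∑[ M ∈ admissibleSets m ] (ext M * ext M)
                   ≤ suc m * (suc (suc m) * p G k (suc (suc m))) + (2 * α G k + 1) * (suc m * p G k (suc m))
  ∑-ext² m = begin
    ∑[ M ∈ admissibleSets m ] (ext M * ext M)            ≤⟨ ∑∈-mono-≤ (admissibleSets m) ext²≤ ⟩
    ∑[ M ∈ admissibleSets m ] (S M + c * ext M)          ≡⟨ ∑∈-distrib-+ (admissibleSets m) S (λ M → c * ext M) ⟩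
    ∑[ M ∈ admissibleSets m ] S M + ∑[ M ∈ admissibleSets m ] (c * ext M)
      ≡⟨ cong₂ _+_ (∑-extensions m ext) (sym (*-distribˡ-∑∈ c (admissibleSets m) ext)) ⟩
    suc m * ∑[ M ∈ admissibleSets (suc m) ] ext M + c * ∑[ M ∈ admissibleSets m ] ext M
      ≡⟨ cong₂ (λ s₁ s₀ → suc m * s₁ + c * s₀) (∑-ext (suc m)) (∑-ext m) ⟩
    suc m * (suc (suc m) * p G k (suc (suc m))) + c * (suc m * p G k (suc m)) ∎
    where
    open ≤-Reasoning
    c : ℕ
    c = 2 * α G k + 1
    S : Subset e → ℕ
    S M = ∑[ i < e ] (𝟙 (does (extends? M i)) * ext (M ∪⁅ i ⁆))

  p-nearLogConcave : ∀ m → suc m * (p G k (suc m) * p G k (suc m))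
                           ≤ p G k m * (suc (suc m) * p G k (suc (suc m)) + (2 * α G k + 1) * p G k (suc m))
  p-nearLogConcave m = *-cancelˡ-≤ (suc m) (begin
    suc m * (suc m * (p₁ * p₁))                ≡⟨ solve 2 (λ a p → a :* (a :* (p :* p)) := (a :* p) :* (a :* p)) refl (suc m) p₁ ⟩
    (suc m * p₁) * (suc m * p₁)                ≡⟨ cong₂ _*_ (∑-ext m) (∑-ext m) ⟨
    (∑[ M ∈ admissibleSets m ] ext M) * (∑[ M ∈ admissibleSets m ] ext M)
                                               ≤⟨ cauchy-schwarz ext (admissibleSets m) ⟩
    p₀ * ∑[ M ∈ admissibleSets m ] (ext M * ext M)
                                               ≤⟨ *-monoʳ-≤ p₀ (∑-ext² m) ⟩
    p₀ * (suc m * (suc (suc m) * p₂) + c * (suc m * p₁))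
      ≡⟨ solve 6 (λ p₀ a b p₂ c p₁ → p₀ :* (a :* (b :* p₂) :+ c :* (a :* p₁)) := a :* (p₀ :* (b :* p₂ :+ c :* p₁)))
                 refl p₀ (suc m) (suc (suc m)) p₂ c p₁ ⟩
    suc m * (p₀ * (suc (suc m) * p₂ + c * p₁)) ∎)
    where
    open ≤-Reasoning
    c p₀ p₁ p₂ : ℕ
    c  = 2 * α G k + 1
    p₀ = p G k m
    p₁ = p G k (suc m)
    p₂ = p G k (suc (suc m))

module Factorials where

  open import Data.Nat using (ℕ; suc; _+_; _*_; _≤_; _!)
  open import Data.Nat.Properties using (*-monoʳ-≤; module ≤-Reasoning)
  open import Data.Nat.Solver using (module +-*-Solver)
  open import Relation.Binary.PropositionalEquality using (refl)
  open +-*-Solver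

  factorial-weighting : ∀ (q : ℕ → ℕ) c m →
    suc m * (q (suc m) * q (suc m)) ≤ q m * (suc (suc m) * q (suc (suc m)) + c * q (suc m)) →
    let b : ℕ → ℕ
        b j = j ! * q j
    in b (suc m) * b (suc m) ≤ b (suc (suc m)) * b m + c * (b m * b (suc m))
  factorial-weighting q c m ulc = begin
    (suc m * m !) * q₁ * ((suc m * m !) * q₁)
      ≡⟨ solve 3 (λ a f q₁ → (a :* f) :* q₁ :* ((a :* f) :* q₁) := (a :* (f :* f)) :* (a :* (q₁ :* q₁)))
                 refl (suc m) (m !) q₁ ⟩
    K * (suc m * (q₁ * q₁))
      ≤⟨ *-monoʳ-≤ K ulc ⟩
    K * (q₀ * (suc (suc m) * q₂ + c * q₁))
      ≡⟨ solve 7 (λ a b f q₀ q₁ q₂ c → (a :* (f :* f)) :* (q₀ :* (b :* q₂ :+ c :* q₁))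
                   := (b :* (a :* f)) :* q₂ :* (f :* q₀) :+ c :* ((f :* q₀) :* ((a :* f) :* q₁)))
               refl (suc m) (suc (suc m)) (m !) q₀ q₁ q₂ c ⟩
    (suc (suc m) * (suc m * m !)) * q₂ * (m ! * q₀) + c * ((m ! * q₀) * ((suc m * m !) * q₁)) ∎
    where
    open ≤-Reasoning
    q₀ q₁ q₂ K : ℕ
    q₀ = q m
    q₁ = q (suc m)
    q₂ = q (suc (suc m))
    K  = suc m * (m ! * m !)

module Ratios where

  open import Data.Nat as ℕ using (ℕ; zero; suc; _!)
  import Data.Nat.Coprimality as Coprime
  open import Data.Integer as ℤ using (+_)
  import Data.Integer.Properties as ℤ
  open import Data.Rational
  open import Data.Rational.Properties
  open import Data.Rational.Solver using (module +-*-Solver)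
  open import Relation.Binary.PropositionalEquality
  open import Relation.Nullary using (yes; no)
  open +-*-Solver
  open Factorials

  ℕ→ℚ≡mkℚ : ∀ a → ℕ→ℚ a ≡ mkℚ (+ a) 0 (Coprime.sym (Coprime.1-coprimeTo a))
  ℕ→ℚ≡mkℚ a = normalize-coprime (Coprime.sym (Coprime.1-coprimeTo a))

  ℕ→ℚ-+ : ∀ a b → ℕ→ℚ (a ℕ.+ b) ≡ ℕ→ℚ a + ℕ→ℚ b
  ℕ→ℚ-+ a b = begin
    + (a ℕ.+ b) / 1                          ≡⟨ cong (_/ 1) (ℤ.pos-+ a b) ⟩
    (+ a ℤ.+ + b) / 1                        ≡⟨ cong (_/ 1) (cong₂ ℤ._+_ (ℤ.*-identityʳ (+ a)) (ℤ.*-identityʳ (+ b))) ⟨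
    (+ a ℤ.* + 1 ℤ.+ + b ℤ.* + 1) / 1        ≡⟨ cong₂ _+_ (ℕ→ℚ≡mkℚ a) (ℕ→ℚ≡mkℚ b) ⟨
    ℕ→ℚ a + ℕ→ℚ b                            ∎
    where open ≡-Reasoning

  ℕ→ℚ-* : ∀ a b → ℕ→ℚ (a ℕ.* b) ≡ ℕ→ℚ a * ℕ→ℚ b
  ℕ→ℚ-* a b = begin
    + (a ℕ.* b) / 1     ≡⟨ cong (_/ 1) (ℤ.pos-* a b) ⟩
    (+ a ℤ.* + b) / 1   ≡⟨ cong₂ _*_ (ℕ→ℚ≡mkℚ a) (ℕ→ℚ≡mkℚ b) ⟨
    ℕ→ℚ a * ℕ→ℚ b       ∎
    where open ≡-Reasoning

  ℕ→ℚ-mono-≤ : ∀ {a b} → a ℕ.≤ b → ℕ→ℚ a ≤ ℕ→ℚ b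
  ℕ→ℚ-mono-≤ {a} {b} a≤b rewrite ℕ→ℚ≡mkℚ a | ℕ→ℚ≡mkℚ b =
    *≤* (subst₂ ℤ._≤_ (sym (ℤ.*-identityʳ (+ a))) (sym (ℤ.*-identityʳ (+ b))) (ℤ.+≤+ a≤b))

  -- t₁ / t₀ − C ≤ t₂ / t₁ with the denominators cleared.
  NearLogConcave : ℚ → ℚ → ℚ → ℚ → Set
  NearLogConcave C t₀ t₁ t₂ = t₁ * t₁ ≤ t₂ * t₀ + C * (t₀ * t₁)

  nearLogConcave-≡ : ∀ {C t₀ t₁ t₂ s₀ s₁ s₂} → t₀ ≡ s₀ → t₁ ≡ s₁ → t₂ ≡ s₂ →
                     NearLogConcave C s₀ s₁ s₂ → NearLogConcave C t₀ t₁ t₂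
  nearLogConcave-≡ refl refl refl nlc = nlc

  nearLogConcave-ℕ→ℚ : ∀ c (x : ℕ → ℕ) m →
    x (suc m) ℕ.* x (suc m) ℕ.≤ x (suc (suc m)) ℕ.* x m ℕ.+ c ℕ.* (x m ℕ.* x (suc m)) →
    NearLogConcave (ℕ→ℚ c) (ℕ→ℚ (x m)) (ℕ→ℚ (x (suc m))) (ℕ→ℚ (x (suc (suc m))))
  nearLogConcave-ℕ→ℚ c x m ineq = subst₂ _≤_ (ℕ→ℚ-* x₁ x₁) rhs (ℕ→ℚ-mono-≤ ineq)
    where
    x₀ x₁ x₂ : ℕ
    x₀ = x m
    x₁ = x (suc m)
    x₂ = x (suc (suc m))
    rhs : ℕ→ℚ (x₂ ℕ.* x₀ ℕ.+ c ℕ.* (x₀ ℕ.* x₁)) ≡ ℕ→ℚ x₂ * ℕ→ℚ x₀ + ℕ→ℚ c * (ℕ→ℚ x₀ * ℕ→ℚ x₁)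
    rhs = trans (ℕ→ℚ-+ (x₂ ℕ.* x₀) (c ℕ.* (x₀ ℕ.* x₁)))
            (cong₂ _+_ (ℕ→ℚ-* x₂ x₀) (trans (ℕ→ℚ-* c (x₀ ℕ.* x₁)) (cong (ℕ→ℚ c *_) (ℕ→ℚ-* x₀ x₁))))

  *-nonNeg : ∀ {p q} → 0ℚ ≤ p → 0ℚ ≤ q → 0ℚ ≤ p * q
  *-nonNeg {p} 0≤p 0≤q = ≤-trans (≤-reflexive (sym (*-zeroʳ p))) (*-monoˡ-≤-nonNeg p {{nonNegative 0≤p}} 0≤q)

  nearLogConcave-geometric : ∀ {C C′} (t g : ℕ → ℚ) m →
    0ℚ ≤ g (suc m) → g (suc m) * g (suc m) ≡ g (suc (suc m)) * g m → C′ * g m ≡ C * g (suc m) →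
    NearLogConcave C (t m) (t (suc m)) (t (suc (suc m))) →
    NearLogConcave C′ (t m * g m) (t (suc m) * g (suc m)) (t (suc (suc m)) * g (suc (suc m)))
  nearLogConcave-geometric {C} {C′} t g m 0≤g₁ g₁²≡g₂g₀ C′g₀≡Cg₁ nlc = begin
    (t₁ * g₁) * (t₁ * g₁)
      ≡⟨ solve 2 (λ t g → (t :* g) :* (t :* g) := (t :* t) :* (g :* g)) refl t₁ g₁ ⟩
    (t₁ * t₁) * (g₁ * g₁)
      ≤⟨ *-monoʳ-≤-nonNeg (g₁ * g₁) {{nonNegative (*-nonNeg 0≤g₁ 0≤g₁)}} nlc ⟩
    (t₂ * t₀ + C * (t₀ * t₁)) * (g₁ * g₁)
      ≡⟨ solve 5 (λ t₀ t₁ t₂ C g → (t₂ :* t₀ :+ C :* (t₀ :* t₁)) :* (g :* g)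
                                   := t₂ :* t₀ :* (g :* g) :+ (C :* g) :* (t₀ :* t₁ :* g)) refl t₀ t₁ t₂ C g₁ ⟩
    t₂ * t₀ * (g₁ * g₁) + (C * g₁) * (t₀ * t₁ * g₁)
      ≡⟨ cong₂ (λ x y → t₂ * t₀ * x + y * (t₀ * t₁ * g₁)) g₁²≡g₂g₀ (sym C′g₀≡Cg₁) ⟩
    t₂ * t₀ * (g₂ * g₀) + (C′ * g₀) * (t₀ * t₁ * g₁)
      ≡⟨ solve 7 (λ t₀ t₁ t₂ C′ g₀ g₁ g₂ → t₂ :* t₀ :* (g₂ :* g₀) :+ (C′ :* g₀) :* (t₀ :* t₁ :* g₁)
                   := (t₂ :* g₂) :* (t₀ :* g₀) :+ C′ :* ((t₀ :* g₀) :* (t₁ :* g₁))) refl t₀ t₁ t₂ C′ g₀ g₁ g₂ ⟩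
    (t₂ * g₂) * (t₀ * g₀) + C′ * ((t₀ * g₀) * (t₁ * g₁)) ∎
    where
    open ≤-Reasoning
    t₀ t₁ t₂ g₀ g₁ g₂ : ℚ
    t₀ = t m
    t₁ = t (suc m)
    t₂ = t (suc (suc m))
    g₀ = g m
    g₁ = g (suc m)
    g₂ = g (suc (suc m))

  ÷'-≡-* : ∀ x y → x ÷' y ≡ x * (1ℚ ÷' y)
  ÷'-≡-* x y with y ≟ 0ℚ
  ... | yes _ = sym (*-zeroʳ x)
  ... | no _  = cong (x *_) (sym (*-identityˡ _))

  ÷'-nonNeg : ∀ {x y} → 0ℚ ≤ x → 0ℚ ≤ y → 0ℚ ≤ x ÷' y
  ÷'-nonNeg {x} {y} 0≤x 0≤y with y ≟ 0ℚ
  ... | yes _   = ≤-refl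
  ... | no y≢0 = *-nonNeg 0≤x (<⇒≤ (positive⁻¹ ((1/ y) {{y≢0′}}) {{1/pos⇒pos y {{0<y}}}}))
    where
    instance
      y≢0′ : NonZero y
      y≢0′ = ≢-nonZero y≢0
      0≤y′ : NonNegative y
      0≤y′ = nonNegative 0≤y
      0<y : Positive y
      0<y = nonNeg∧nonZero⇒pos y

  -C≤0 : ∀ {C} → 0ℚ ≤ C → 0ℚ - C ≤ 0ℚ
  -C≤0 {C} 0≤C = ≤-trans (≤-reflexive (+-identityˡ (- C))) (neg-antimono-≤ 0≤C)

  -- If t₀ or t₁ is 0 then ÷' returns 0 on the left, and the right side is nonnegative.
  nearLogConcave⇒ratio : ∀ {C t₀ t₁ t₂} → 0ℚ ≤ C → 0ℚ ≤ t₀ → 0ℚ ≤ t₁ → 0ℚ ≤ t₂ →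
    NearLogConcave C t₀ t₁ t₂ → t₁ ÷' t₀ - C ≤ t₂ ÷' t₁
  nearLogConcave⇒ratio {C} {t₀} {t₁} {t₂} 0≤C 0≤t₀ 0≤t₁ 0≤t₂ nlc with t₀ ≟ 0ℚ
  ... | yes _ = ≤-trans (-C≤0 0≤C) (÷'-nonNeg 0≤t₂ 0≤t₁)
  ... | no t₀≢0 with t₁ ≟ 0ℚ
  ...   | yes refl = ≤-trans (≤-reflexive (cong (_- C) (*-zeroˡ (1/ t₀)))) (-C≤0 0≤C)
    where instance _ = ≢-nonZero t₀≢0
  ...   | no t₁≢0 = *-cancelʳ-≤-pos (t₀ * t₁) (begin
    (t₁ * 1/ t₀ - C) * (t₀ * t₁)
      ≡⟨ solve 4 (λ t₀ t₁ i₀ C → (t₁ :* i₀ :- C) :* (t₀ :* t₁) := t₁ :* t₁ :* (i₀ :* t₀) :- C :* (t₀ :* t₁))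
                 refl t₀ t₁ (1/ t₀) C ⟩
    t₁ * t₁ * (1/ t₀ * t₀) - C * (t₀ * t₁)
      ≡⟨ cong (λ x → t₁ * t₁ * x - C * (t₀ * t₁)) (*-inverseˡ t₀) ⟩
    t₁ * t₁ * 1ℚ - C * (t₀ * t₁)
      ≤⟨ +-monoˡ-≤ (- (C * (t₀ * t₁))) (≤-trans (≤-reflexive (*-identityʳ (t₁ * t₁))) nlc) ⟩
    t₂ * t₀ + C * (t₀ * t₁) - C * (t₀ * t₁)
      ≡⟨ solve 4 (λ t₀ t₁ t₂ C → t₂ :* t₀ :+ C :* (t₀ :* t₁) :- C :* (t₀ :* t₁) := t₂ :* t₀ :* con 1ℚ)
                 refl t₀ t₁ t₂ C ⟩
    t₂ * t₀ * 1ℚ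
      ≡⟨ cong (t₂ * t₀ *_) (*-inverseˡ t₁) ⟨
    t₂ * t₀ * (1/ t₁ * t₁)
      ≡⟨ solve 4 (λ t₀ t₁ t₂ i₁ → t₂ :* t₀ :* (i₁ :* t₁) := t₂ :* i₁ :* (t₀ :* t₁)) refl t₀ t₁ t₂ (1/ t₁) ⟩
    t₂ * 1/ t₁ * (t₀ * t₁) ∎)
    where
    open ≤-Reasoning
    instance
      t₀≢0′ : NonZero t₀
      t₀≢0′ = ≢-nonZero t₀≢0
      t₁≢0′ : NonZero t₁
      t₁≢0′ = ≢-nonZero t₁≢0
      0<t₀ : Positive t₀
      0<t₀ = nonNeg∧nonZero⇒pos t₀ {{nonNegative 0≤t₀}}
      0<t₁ : Positive t₁
      0<t₁ = nonNeg∧nonZero⇒pos t₁ {{nonNegative 0≤t₁}}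
      0<t₀t₁ : Positive (t₀ * t₁)
      0<t₀t₁ = pos*pos⇒pos t₀ t₁

  ℕ→ℚ-nonNeg : ∀ a → 0ℚ ≤ ℕ→ℚ a
  ℕ→ℚ-nonNeg a = ℕ→ℚ-mono-≤ {0} {a} ℕ.z≤n

  ^ℚ-nonNeg : ∀ {z} → 0ℚ ≤ z → ∀ j → 0ℚ ≤ z ^ℚ j
  ^ℚ-nonNeg 0≤z zero    = ℕ→ℚ-nonNeg 1
  ^ℚ-nonNeg 0≤z (suc j) = *-nonNeg 0≤z (^ℚ-nonNeg 0≤z j)

  polyP-nonNeg : ∀ (q : ℕ → ℕ) N {z} → 0ℚ ≤ z → 0ℚ ≤ polyP q N z
  polyP-nonNeg q zero    0≤z = ℕ→ℚ-nonNeg (q 0)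
  polyP-nonNeg q (suc N) 0≤z =
    +-mono-≤ (polyP-nonNeg q N 0≤z) (*-nonNeg (ℕ→ℚ-nonNeg (q (suc N))) (^ℚ-nonNeg 0≤z (suc N)))

  T≡ : ∀ (q : ℕ → ℕ) N z j → T q N z j ≡ ℕ→ℚ (j ! ℕ.* q j) * (z ^ℚ j * (1ℚ ÷' polyP q N z))
  T≡ q N z j = begin
    (ℕ→ℚ (j !) * ℕ→ℚ (q j) * z ^ℚ j) ÷' polyP q N z   ≡⟨ ÷'-≡-* _ (polyP q N z) ⟩
    ℕ→ℚ (j !) * ℕ→ℚ (q j) * z ^ℚ j * r                ≡⟨ cong (λ x → x * z ^ℚ j * r) (ℕ→ℚ-* (j !) (q j)) ⟨
    ℕ→ℚ (j ! ℕ.* q j) * z ^ℚ j * r                     ≡⟨ *-assoc (ℕ→ℚ (j ! ℕ.* q j)) (z ^ℚ j) r ⟩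
    ℕ→ℚ (j ! ℕ.* q j) * (z ^ℚ j * r)                   ∎
    where
    open ≡-Reasoning
    r : ℚ
    r = 1ℚ ÷' polyP q N z

  T-nonNeg : ∀ (q : ℕ → ℕ) N {z} → 0ℚ ≤ z → ∀ j → 0ℚ ≤ T q N z j
  T-nonNeg q N 0≤z j = ÷'-nonNeg
    (*-nonNeg (*-nonNeg (ℕ→ℚ-nonNeg (j !)) (ℕ→ℚ-nonNeg (q j))) (^ℚ-nonNeg 0≤z j)) (polyP-nonNeg q N 0≤z)

  T-nearLogConcave : ∀ (q : ℕ → ℕ) N c m {z} → 0ℚ ≤ z →
    suc m ℕ.* (q (suc m) ℕ.* q (suc m)) ℕ.≤ q m ℕ.* (suc (suc m) ℕ.* q (suc (suc m)) ℕ.+ c ℕ.* q (suc m)) →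
    NearLogConcave (ℕ→ℚ c * z) (T q N z m) (T q N z (suc m)) (T q N z (suc (suc m)))
  T-nearLogConcave q N c m {z} 0≤z ulc =
    nearLogConcave-≡ {C = ℕ→ℚ c * z} (T≡ q N z m) (T≡ q N z (suc m)) (T≡ q N z (suc (suc m)))
      (nearLogConcave-geometric {ℕ→ℚ c} {ℕ→ℚ c * z} b g m 0≤g₁ g₁²≡g₂g₀ cz·g₀≡c·g₁
        (nearLogConcave-ℕ→ℚ c (λ j → j ! ℕ.* q j) m (factorial-weighting q c m ulc)))
    where
    r : ℚ
    r = 1ℚ ÷' polyP q N z
    b g : ℕ → ℚ
    b j = ℕ→ℚ (j ! ℕ.* q j)
    g j = z ^ℚ j * r
    0≤g₁ : 0ℚ ≤ g (suc m)
    0≤g₁ = *-nonNeg (^ℚ-nonNeg 0≤z (suc m)) (÷'-nonNeg (ℕ→ℚ-nonNeg 1) (polyP-nonNeg q N 0≤z))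
    g₁²≡g₂g₀ : g (suc m) * g (suc m) ≡ g (suc (suc m)) * g m
    g₁²≡g₂g₀ = solve 3 (λ z w r → z :* w :* r :* (z :* w :* r) := z :* (z :* w) :* r :* (w :* r)) refl z (z ^ℚ m) r
    cz·g₀≡c·g₁ : ℕ→ℚ c * z * g m ≡ ℕ→ℚ c * g (suc m)
    cz·g₀≡c·g₁ = solve 4 (λ c z w r → c :* z :* (w :* r) := c :* (z :* w :* r)) refl (ℕ→ℚ c) z (z ^ℚ m) r

  T-ratio : ∀ (q : ℕ → ℕ) N c m {z} → 0ℚ ≤ z →
    suc m ℕ.* (q (suc m) ℕ.* q (suc m)) ℕ.≤ q m ℕ.* (suc (suc m) ℕ.* q (suc (suc m)) ℕ.+ c ℕ.* q (suc m)) →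
    T q N z (suc m) ÷' T q N z m - ℕ→ℚ c * z ≤ T q N z (suc (suc m)) ÷' T q N z (suc m)
  T-ratio q N c m {z} 0≤z ulc =
    nearLogConcave⇒ratio {C = ℕ→ℚ c * z} (*-nonNeg (ℕ→ℚ-nonNeg c) 0≤z)
      (T-nonNeg q N 0≤z m) (T-nonNeg q N 0≤z (suc m)) (T-nonNeg q N 0≤z (suc (suc m)))
      (T-nearLogConcave q N c m 0≤z ulc)

open import Data.Nat using (ℕ; suc; _<_; _≤_; _+_) renaming (_*_ to _*ℕ_)
open import Data.Fin using (Fin)
open import Data.Rational using (ℚ; 0ℚ; _-_; _*_) renaming (_≤_ to _≤ℚ_; _<_ to _<ℚ_)
open import Data.Rational.Properties using (<⇒≤)
open import Relation.Binary.PropositionalEquality using (_≡_)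

proposition6p2 : (G : MultiGraph) (k : Fin (MultiGraph.n G) → ℕ)
    → (∀ v → 0 < deg G v)
    → (∀ v → 1 ≤ k v)
    → (N : ℕ) → 0 < p G k N → (∀ m → N < m → p G k m ≡ 0)
    → (z0 : ℚ) → 0ℚ <ℚ z0
    → ∀ m → m + 2 ≤ N
    → (T (p G k) N z0 (suc m) ÷' T (p G k) N z0 m) - ℕ→ℚ (2 *ℕ α G k + 1) * z0
        ≤ℚ T (p G k) N z0 (suc (suc m)) ÷' T (p G k) N z0 (suc m)
proposition6p2 G k _ _ N _ _ z0 0<z0 m _ =
  Ratios.T-ratio (p G k) N (2 *ℕ α G k + 1) m (<⇒≤ 0<z0) (Extensions.p-nearLogConcave G k m)
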